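{- Let $\mathbb{F}$ be a field of characteristic $p>0$, $d\ge 2$, $n\ge1$, and let $T\in\mathsf T^d(n)$ satisfy $\mathrm{prank}(T) < n/(p-1)$. Then $\det(T)=0$. Equivalently, $\det(T)\neq 0$ implies $\mathrm{prank}(T)\ge n/(p-1)$.
   Context: $\mathsf{T}^d(n)$ denotes the set of functions $T:[n]^d \to \mathbb{F}$. The hyperdeterminant is $\det(T) = \sum_{\sigma_2,\dots,\sigma_d \in S_n} \mathrm{sgn}(\sigma_2\cdots\sigma_d)\prod_{i=1}^n T(i,\sigma_2(i),\dots,\sigma_d(i))$ (for any $d$). The partition rank $\mathrm{prank}(T)$ is the minimal $r$ such that $T$ is a sum of $r$ simple tensors ($0$ iff $T=0$), where a simple tensor has the form $T(i_1,\dots,i_d)=T_1(i_{a_1},\dots,i_{a_k})\,T_2(i_{b_1},\dots,i_{b_{d-k}})$ for some partition $\{a_1<\dots<a_k\}\cup\{b_1<\dots<b_{d-k}\}=[d]$ into two nonempty blocks and nonzero $T_1\in\mathsf T^k(n)$, $T_2\in\mathsf T^{d-k}(n)$ (the partition may differ between simple tensors). -}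

module Defs where

open import Level using (Level; _⊔_)
open import Data.Nat as ℕ using (ℕ; zero; suc; _<_; _≤_; _<ᵇ_)
open import Data.Fin using (Fin; zero; suc; toℕ)
open import Data.Bool using (Bool; true; false; not; if_then_else_)
open import Data.List as List using (List; []; _∷_; allFin; concatMap; foldr)
open import Data.Vec using (Vec; []; _∷_)
import Data.Vec as Vec
import Data.Vec.Functional as VF
open import Data.Product using (Σ; ∃; _×_; _,_)
open import Relation.Nullary using (¬_)
open import Algebra.Bundles using (CommutativeRing)

record Field (c ℓ : Level) : Set (Level.suc (c ⊔ ℓ)) where
  field
    commutativeRing : CommutativeRing c ℓ
  open CommutativeRing commutativeRing public
  field
    1≉0     : ¬ (1# ≈ 0#)
    inverse : ∀ x → ¬ (x ≈ 0#) → Σ Carrier λ y → x * y ≈ 1#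

module _ {c ℓ : Level} (F : Field c ℓ) where
  open Field F

  ι : ℕ → Carrier
  ι zero    = 0#
  ι (suc k) = 1# + ι k

  HasCharacteristic : ℕ → Set ℓ
  HasCharacteristic p =
    (0 < p) × (ι p ≈ 0#) × (∀ m → 0 < m → m < p → ¬ (ι m ≈ 0#))

  sumL : List Carrier → Carrier
  sumL = foldr _+_ 0#

  prodL : List Carrier → Carrier
  prodL = foldr _*_ 1#

  sumFin : (r : ℕ) → (Fin r → Carrier) → Carrier
  sumFin r f = sumL (List.map f (allFin r))

  prodFin : (r : ℕ) → (Fin r → Carrier) → Carrier
  prodFin r f = prodL (List.map f (allFin r))

  Tensor : ℕ → ℕ → Set c
  Tensor d n = (Fin d → Fin n) → Carrier

  pairSign : ∀ {n} → Fin n → Fin n → Carrier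
  pairSign a b =
    if toℕ a <ᵇ toℕ b then 1# else (if toℕ b <ᵇ toℕ a then - 1# else 0#)

  -- sign of a map σ : [n] → [n] via inversions:
  --   sgn σ = ∏_{i<j} sign(σ j − σ i)
  -- which is the usual signature when σ is a permutation and 0 otherwise.
  sgn : ∀ {n} → (Fin n → Fin n) → Carrier
  sgn {n} σ = prodFin n λ i → prodFin n λ j →
    if toℕ i <ᵇ toℕ j then pairSign (σ i) (σ j) else 1#

allFuns : ∀ {a} {A : Set a} (m : ℕ) → List A → List (Fin m → A)
allFuns zero    xs = (λ ()) ∷ []
allFuns (suc m) xs =
  concatMap (λ x → List.map (λ f → x VF.∷ f) (allFuns m xs)) xs

allMaps : (n : ℕ) → List (Fin n → Fin n)
allMaps n = allFuns n (allFin n)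

module _ {c ℓ : Level} (F : Field c ℓ) where
  open Field F

  -- Summing over all maps instead of permutations is harmless since
  -- sgn vanishes on non-bijections.
  hdet : ∀ {m n} → Tensor F (ℕ.suc m) n → Carrier
  hdet {m} {n} T =
    sumL F (List.map
      (λ (σ : Fin m → Fin n → Fin n) →
        prodFin F m (λ k → sgn F (σ k)) *
        prodFin F n (λ i → T (i VF.∷ (λ k → σ k i))))
      (allFuns m (allMaps n)))

-- Partitions of [d] into two blocks, encoded by a subset S (Vec Bool d):
-- block {a₁<…<a_k} = positions with true, complement = positions with false.

size : ∀ {d} → Vec Bool d → ℕ
size []          = 0
size (true ∷ S)  = suc (size S)
size (false ∷ S) = size S

sel : ∀ {a} {A : Set a} {d} (S : Vec Bool d) → (Fin d → A) → (Fin (size S) → A)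
sel []          x = λ ()
sel (true ∷ S)  x = x zero VF.∷ sel S (λ i → x (suc i))
sel (false ∷ S) x = sel S (λ i → x (suc i))

module _ {c ℓ : Level} (F : Field c ℓ) where
  open Field F

  NonzeroTensor : ∀ {k n} → Tensor F k n → Set ℓ
  NonzeroTensor T = ¬ (∀ x → T x ≈ 0#)

  IsSimple : ∀ {d n} → Tensor F d n → Set (c ⊔ ℓ)
  IsSimple {d} {n} U =
    Σ (Vec Bool d) λ S →
      (1 ≤ size S) × (1 ≤ size (Vec.map not S)) ×
      Σ (Tensor F (size S) n) λ T₁ →
      Σ (Tensor F (size (Vec.map not S)) n) λ T₂ →
        NonzeroTensor T₁ × NonzeroTensor T₂ ×
        (∀ x → U x ≈ T₁ (sel S x) * T₂ (sel (Vec.map not S) x))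

  -- T is a sum of r simple tensors (i.e. prank T ≤ r)
  SumOfSimple : ∀ {d n} → ℕ → Tensor F d n → Set (c ⊔ ℓ)
  SumOfSimple {d} {n} r T =
    Σ (Fin r → Tensor F d n) λ U →
      (∀ j → IsSimple (U j)) × (∀ x → T x ≈ sumFin F r (λ j → U j x))

{-# OPTIONS --safe #-}
module Submission where

-- Expanding hdet T = ∑_σ sgn σ ∏_i ∑_j U_j (i, σ i) multilinearly gives one sum for each
-- assignment f of a summand U_{f i} to every row i. As r (p − 1) < n, some simple summand U_j
-- is assigned to at least p rows. U_j splits off a nonempty set Q of coordinates not containing
-- the first, so exchanging the Q-coordinates of two of these rows does not change ∏_i U_{f i},
-- while it composes each σ_k with k ∈ Q with a transposition and so multiplies the sign by
-- ε = (−1)^|Q|. For a set J of such rows, sort the terms by the row of J carrying the largest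
-- value of a fixed σ_{k₀} with k₀ ∈ Q (terms where σ_{k₀} is not injective on J vanish): the
-- sum for f becomes Y + (|J| − 1) ε Y, which is 0 for |J| = p if ε = 1 and for |J| = 2 if ε = −1.

open import Defs
open import Level using (Level; _⊔_)
open import Data.Nat as ℕ using (ℕ; zero; suc; _∸_; _<_; _≤_; z≤n; s≤s; z<s; _<ᵇ_)
import Data.Nat.Properties as ℕ
open import Data.Nat.ListAction using (sum)
open import Data.Fin as Fin using (Fin; zero; suc; toℕ)
import Data.Fin.Properties as Fin
open import Data.Bool using (Bool; true; false; not; if_then_else_; T)
open import Data.Bool.Properties using (not-involutive)
open import Data.Empty using (⊥-elim)
open import Data.Product using (∃; ∃₂; _×_; _,_; proj₁; proj₂)
open import Data.Sum using (_⊎_; inj₁; inj₂)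
open import Data.Vec as Vec using (Vec; []; _∷_)
import Data.Vec.Properties as Vec
import Data.Vec.Functional as Vector
open import Data.List as List using (List; []; _∷_; _++_; allFin; concatMap; length; filter)
import Data.List.Properties as List
open import Data.List.Membership.Propositional using (_∈_)
open import Data.List.Membership.Propositional.Properties using (∈-allFin)
open import Data.List.Relation.Unary.Any using (here; there)
open import Data.List.Relation.Unary.All as All using (All; []; _∷_)
import Data.List.Relation.Unary.All.Properties as All
open import Data.List.Relation.Unary.AllPairs as AllPairs using ([]; _∷_)
open import Data.List.Relation.Unary.Unique.Propositional using (Unique)
import Data.List.Relation.Unary.Unique.Propositional.Properties as Unique
open import Function using (_∘_; id)
open import Relation.Binary.Definitions using (tri<; tri≈; tri>)
open import Relation.Binary.PropositionalEquality as ≡ using (_≡_; _≢_; _≗_; module ≡-Reasoning)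
open import Relation.Nullary using (Dec; does; yes; no; ¬?)
open import Relation.Nullary.Decidable using (dec-true; dec-false; _→-dec_)
import Algebra.Properties.CommutativeSemigroup as CommutativeSemigroupProperties

transposeℕ : ℕ → ℕ → ℕ → ℕ
transposeℕ x y i = if does (i ℕ.≟ x) then y else if does (i ℕ.≟ y) then x else i

transposeℕ-left : ∀ x y → transposeℕ x y x ≡ y
transposeℕ-left x y rewrite dec-true (x ℕ.≟ x) ≡.refl = ≡.refl

transposeℕ-right : ∀ x y → transposeℕ x y y ≡ x
transposeℕ-right x y with y ℕ.≟ x
... | yes ≡.refl = transposeℕ-left x x
... | no y≢x rewrite dec-false (y ℕ.≟ x) y≢x | dec-true (y ℕ.≟ y) ≡.refl = ≡.refl

transposeℕ-other : ∀ {x y i} → i ≢ x → i ≢ y → transposeℕ x y i ≡ i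
transposeℕ-other {x} {y} {i} i≢x i≢y
  rewrite dec-false (i ℕ.≟ x) i≢x | dec-false (i ℕ.≟ y) i≢y = ≡.refl

transposeℕ-suc : ∀ x y i → transposeℕ (suc x) (suc y) (suc i) ≡ suc (transposeℕ x y i)
transposeℕ-suc x y i with i ℕ.≡ᵇ x
... | true = ≡.refl
... | false with i ℕ.≡ᵇ y
...   | true  = ≡.refl
...   | false = ≡.refl

transposeℕ-conjugate : ∀ {a c} x → a < c →
  transposeℕ c (suc c) (transposeℕ a c (transposeℕ c (suc c) x)) ≡ transposeℕ a (suc c) x
transposeℕ-conjugate {a} {c} x a<c with x ℕ.≟ c | ℕ.>⇒≢ a<c | ℕ.>⇒≢ (ℕ.m<n⇒m<1+n a<c)
... | yes ≡.refl | c≢a | 1+c≢a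
  rewrite transposeℕ-left x (suc x) | transposeℕ-other {a} {x} {suc x} 1+c≢a ℕ.1+n≢n
        | transposeℕ-right x (suc x) | transposeℕ-other {a} {suc x} {x} c≢a (ℕ.1+n≢n ∘ ≡.sym) = ≡.refl
... | no x≢c | c≢a | 1+c≢a with x ℕ.≟ suc c
...   | yes ≡.refl
  rewrite transposeℕ-right c (suc c) | transposeℕ-right a c
        | transposeℕ-other {c} {suc c} {a} (c≢a ∘ ≡.sym) (1+c≢a ∘ ≡.sym) | transposeℕ-right a (suc c) = ≡.refl
...   | no x≢1+c with x ℕ.≟ a
...     | yes ≡.refl
  rewrite transposeℕ-other {c} {suc c} {x} x≢c x≢1+c | transposeℕ-left x c
        | transposeℕ-left c (suc c) | transposeℕ-left x (suc c) = ≡.refl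
...     | no x≢a
  rewrite transposeℕ-other {c} {suc c} {x} x≢c x≢1+c | transposeℕ-other {a} {c} {x} x≢a x≢c
        | transposeℕ-other {c} {suc c} {x} x≢c x≢1+c | transposeℕ-other {a} {suc c} {x} x≢a x≢1+c = ≡.refl

-- swapAdjacent t exchanges t and t + 1, and is the identity when t + 1 is out of range.
swapAdjacent : ∀ {n} → ℕ → Fin n → Fin n
swapAdjacent {suc zero}    t             i             = i
swapAdjacent {suc (suc n)} zero          zero          = suc zero
swapAdjacent {suc (suc n)} zero          (suc zero)    = zero
swapAdjacent {suc (suc n)} zero          (suc (suc i)) = suc (suc i)
swapAdjacent {suc (suc n)} (suc t)       zero          = zero
swapAdjacent {suc (suc n)} (suc t)       (suc i)       = suc (swapAdjacent t i)

toℕ-swapAdjacent : ∀ {n} t (i : Fin n) → suc t < n →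
  toℕ (swapAdjacent t i) ≡ transposeℕ t (suc t) (toℕ i)
toℕ-swapAdjacent {suc zero}    t       zero          (s≤s ())
toℕ-swapAdjacent {suc (suc n)} zero    zero          _         = ≡.refl
toℕ-swapAdjacent {suc (suc n)} zero    (suc zero)    _         = ≡.refl
toℕ-swapAdjacent {suc (suc n)} zero    (suc (suc i)) _         = ≡.refl
toℕ-swapAdjacent {suc (suc n)} (suc t) zero          _         = ≡.refl
toℕ-swapAdjacent {suc (suc n)} (suc t) (suc i)       (s≤s t<n) =
  ≡.trans (≡.cong suc (toℕ-swapAdjacent t i t<n)) (≡.sym (transposeℕ-suc t (suc t) (toℕ i)))

-- The transposition of a and a + 1 + k, written as a conjugate of adjacent swaps so that its
-- action on signs and on sums over maps follows by induction on k.
transposeAt : ∀ {n} → ℕ → ℕ → Fin n → Fin n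
transposeAt a zero    = swapAdjacent a
transposeAt a (suc k) = swapAdjacent (a ℕ.+ suc k) ∘ transposeAt a k ∘ swapAdjacent (a ℕ.+ suc k)

toℕ-transposeAt : ∀ {n} a k (i : Fin n) → a ℕ.+ suc k < n →
  toℕ (transposeAt a k i) ≡ transposeℕ a (a ℕ.+ suc k) (toℕ i)
toℕ-transposeAt a zero i lt rewrite ℕ.+-comm a 1 = toℕ-swapAdjacent a i lt
toℕ-transposeAt {n} a (suc k) i lt = begin
  toℕ (swapAdjacent c (transposeAt a k (swapAdjacent c i)))
    ≡⟨ toℕ-swapAdjacent c _ 1+c<n ⟩
  transposeℕ c (suc c) (toℕ (transposeAt a k (swapAdjacent c i)))
    ≡⟨ ≡.cong (transposeℕ c (suc c)) (toℕ-transposeAt a k _ (ℕ.<-trans (ℕ.n<1+n c) 1+c<n)) ⟩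
  transposeℕ c (suc c) (transposeℕ a c (toℕ (swapAdjacent c i)))
    ≡⟨ ≡.cong (transposeℕ c (suc c) ∘ transposeℕ a c) (toℕ-swapAdjacent c i 1+c<n) ⟩
  transposeℕ c (suc c) (transposeℕ a c (transposeℕ c (suc c) (toℕ i)))
    ≡⟨ transposeℕ-conjugate (toℕ i) (ℕ.m<m+n a z<s) ⟩
  transposeℕ a (suc c) (toℕ i)
    ≡⟨ ≡.cong (λ b → transposeℕ a b (toℕ i)) (≡.sym (ℕ.+-suc a (suc k))) ⟩
  transposeℕ a (a ℕ.+ suc (suc k)) (toℕ i) ∎
  where
  open ≡-Reasoning
  c = a ℕ.+ suc k
  1+c<n : suc c < n
  1+c<n = ≡.subst (_< n) (ℕ.+-suc a (suc k)) lt

record IsTransposition {n} (τ : Fin n → Fin n) (a b : Fin n) : Set where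
  field
    image-left  : τ a ≡ b
    image-right : τ b ≡ a
    fixes       : ∀ {i} → i ≢ a → i ≢ b → τ i ≡ i

isTransposition-sym : ∀ {n} {τ : Fin n → Fin n} {a b} → IsTransposition τ a b → IsTransposition τ b a
isTransposition-sym τ-swaps = record
  { image-left = image-right ; image-right = image-left ; fixes = λ i≢b i≢a → fixes i≢a i≢b }
  where open IsTransposition τ-swaps

isTransposition-transposeAt : ∀ {n} {a b : Fin n} (a<b : a Fin.< b) →
  IsTransposition (transposeAt (toℕ a) (toℕ b ∸ suc (toℕ a))) a b
isTransposition-transposeAt {n} {a} {b} a<b = record
  { image-left  = Fin.toℕ-injective (begin
      toℕ (τ a)                         ≡⟨ toℕ-τ a ⟩
      transposeℕ (toℕ a) b′ (toℕ a)     ≡⟨ transposeℕ-left (toℕ a) b′ ⟩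
      b′                                ≡⟨ b′≡b ⟩
      toℕ b ∎)
  ; image-right = Fin.toℕ-injective (begin
      toℕ (τ b)                         ≡⟨ toℕ-τ b ⟩
      transposeℕ (toℕ a) b′ (toℕ b)     ≡⟨ ≡.cong (λ z → transposeℕ (toℕ a) z (toℕ b)) b′≡b ⟩
      transposeℕ (toℕ a) (toℕ b) (toℕ b) ≡⟨ transposeℕ-right (toℕ a) (toℕ b) ⟩
      toℕ a ∎)
  ; fixes = λ {i} i≢a i≢b → Fin.toℕ-injective (≡.trans (toℕ-τ i)
      (transposeℕ-other (i≢a ∘ Fin.toℕ-injective) (i≢b ∘ Fin.toℕ-injective ∘ (λ e → ≡.trans e b′≡b))))
  }
  where
  open ≡-Reasoning
  k  = toℕ b ∸ suc (toℕ a)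
  b′ = toℕ a ℕ.+ suc k
  τ  = transposeAt {n} (toℕ a) k
  b′≡b : b′ ≡ toℕ b
  b′≡b = ≡.trans (ℕ.+-suc (toℕ a) k) (ℕ.m+[n∸m]≡n a<b)
  toℕ-τ : ∀ i → toℕ (τ i) ≡ transposeℕ (toℕ a) b′ (toℕ i)
  toℕ-τ i = toℕ-transposeAt (toℕ a) k i (≡.subst (_< n) (≡.sym b′≡b) (Fin.toℕ<n b))

IsArgmax : ∀ {n k} → List (Fin n) → (Fin n → Fin k) → Fin n → Set
IsArgmax J v c = All (λ i → i ≢ c → v i Fin.< v c) J

isArgmax? : ∀ {n k} J (v : Fin n → Fin k) c → Dec (IsArgmax J v c)
isArgmax? J v c = All.all? (λ i → ¬? (i Fin.≟ c) →-dec (v i Fin.<? v c)) J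

module _ {n k : ℕ} {J : List (Fin n)} where

  isArgmax-unique : ∀ {v : Fin n → Fin k} {c c'} → c ∈ J → c' ∈ J →
    IsArgmax J v c → IsArgmax J v c' → c ≡ c'
  isArgmax-unique {c = c} {c'} c∈J c'∈J max-c max-c' with c Fin.≟ c'
  ... | yes c≡c' = c≡c'
  ... | no c≢c' = ⊥-elim (Fin.<-asym (All.lookup max-c c'∈J (c≢c' ∘ ≡.sym)) (All.lookup max-c' c∈J c≢c'))

  isArgmax-resp : ∀ {v v' : Fin n → Fin k} {c} → v ≗ v' → IsArgmax J v c → IsArgmax J v' c
  isArgmax-resp {c = c} v≗v' = All.map λ {i} lt i≢c → ≡.subst₂ Fin._<_ (v≗v' i) (v≗v' c) (lt i≢c)

  isArgmax-transposed : ∀ {τ} {a b} (v : Fin n → Fin k) → IsTransposition τ a b → a ∈ J → b ∈ J → a ≢ b →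
    (IsArgmax J (v ∘ τ) a → IsArgmax J v b) × (IsArgmax J v b → IsArgmax J (v ∘ τ) a)
  isArgmax-transposed {τ} {a} {b} v τ-swaps a∈J b∈J a≢b = to , from
    where
    open IsTransposition τ-swaps
    to : IsArgmax J (v ∘ τ) a → IsArgmax J v b
    to max = All.tabulate λ {i} i∈J i≢b → ≡.subst (λ z → v _ Fin.< v z) image-left (after i i∈J i≢b)
      where
      after : ∀ i → i ∈ J → i ≢ b → v i Fin.< v (τ a)
      after i i∈J i≢b with i Fin.≟ a
      ... | yes ≡.refl = ≡.subst (λ z → v z Fin.< v (τ i)) image-right (All.lookup max b∈J (a≢b ∘ ≡.sym))
      ... | no i≢a   = ≡.subst (λ z → v z Fin.< v (τ a)) (fixes i≢a i≢b) (All.lookup max i∈J i≢a)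
    from : IsArgmax J v b → IsArgmax J (v ∘ τ) a
    from max = All.tabulate λ {i} i∈J i≢a → ≡.subst (λ z → v (τ i) Fin.< v z) (≡.sym image-left) (before i i∈J i≢a)
      where
      before : ∀ i → i ∈ J → i ≢ a → v (τ i) Fin.< v b
      before i i∈J i≢a with i Fin.≟ b
      ... | yes ≡.refl = ≡.subst (λ z → v z Fin.< v i) (≡.sym image-right) (All.lookup max a∈J a≢b)
      ... | no i≢b   = ≡.subst (λ z → v z Fin.< v b) (≡.sym (fixes i≢a i≢b)) (All.lookup max i∈J i≢b)

Collision : ∀ {n k} → List (Fin n) → (Fin n → Fin k) → Set
Collision J v = ∃₂ λ i i' → i ∈ J × i' ∈ J × i ≢ i' × v i ≡ v i'

argmax-or-collision : ∀ {n k} x (xs : List (Fin n)) → Unique (x ∷ xs) → (v : Fin n → Fin k) →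
  (∃ λ c → c ∈ x ∷ xs × IsArgmax (x ∷ xs) v c) ⊎ Collision (x ∷ xs) v
argmax-or-collision x [] _ v = inj₁ (x , here ≡.refl , (λ x≢x → ⊥-elim (x≢x ≡.refl)) ∷ [])
argmax-or-collision x (y ∷ ys) (x∉ ∷ unique) v with argmax-or-collision y ys unique v
... | inj₂ (i , i' , i∈ , i'∈ , i≢i' , vi≡vi') = inj₂ (i , i' , there i∈ , there i'∈ , i≢i' , vi≡vi')
... | inj₁ (c , c∈ , max-c) with Fin.<-cmp (v x) (v c)
...   | tri< vx<vc _ _ = inj₁ (c , there c∈ , (λ _ → vx<vc) ∷ max-c)
...   | tri≈ _ vx≡vc _ = inj₂ (x , c , here ≡.refl , there c∈ , All.lookup x∉ c∈ , vx≡vc)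
...   | tri> _ _ vc<vx = inj₁ (x , here ≡.refl , (λ x≢x → ⊥-elim (x≢x ≡.refl)) ∷ All.tabulate below)
  where
  below : ∀ {i} → i ∈ y ∷ ys → i ≢ x → v i Fin.< v x
  below {i} i∈ _ with i Fin.≟ c
  ... | yes ≡.refl = vc<vx
  ... | no i≢c   = Fin.<-trans (All.lookup max-c i∈ i≢c) vc<vx

fibre : ∀ {n r} → (Fin n → Fin r) → Fin r → List (Fin n)
fibre {n} f j = filter (λ i → f i Fin.≟ j) (allFin n)

fibre-unique : ∀ {n r} (f : Fin n → Fin r) j → Unique (fibre f j)
fibre-unique {n} f j = Unique.filter⁺ (λ i → f i Fin.≟ j) (Unique.allFin⁺ n)

fibre-sound : ∀ {n r} (f : Fin n → Fin r) j → All (λ i → f i ≡ j) (fibre f j)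
fibre-sound {n} f j = All.all-filter (λ i → f i Fin.≟ j) (allFin n)

sum-tabulate-+ : ∀ {r} (g h : Fin r → ℕ) →
  sum (List.tabulate λ j → g j ℕ.+ h j) ≡ sum (List.tabulate g) ℕ.+ sum (List.tabulate h)
sum-tabulate-+ {zero}  g h = ≡.refl
sum-tabulate-+ {suc r} g h = ≡.trans (≡.cong (g zero ℕ.+ h zero ℕ.+_) (sum-tabulate-+ (g ∘ suc) (h ∘ suc)))
  (interchange (g zero) (h zero) (sum (List.tabulate (g ∘ suc))) (sum (List.tabulate (h ∘ suc))))
  where open CommutativeSemigroupProperties ℕ.+-commutativeSemigroup using (interchange)

sum-tabulate-zero : ∀ r → sum (List.tabulate {n = r} λ _ → 0) ≡ 0
sum-tabulate-zero zero    = ≡.refl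
sum-tabulate-zero (suc r) = sum-tabulate-zero r

sum-tabulate-indicator : ∀ {r} (a : Fin r) → sum (List.tabulate λ j → if does (a Fin.≟ j) then 1 else 0) ≡ 1
sum-tabulate-indicator {suc r} zero    = ≡.cong suc (sum-tabulate-zero r)
sum-tabulate-indicator {suc r} (suc a) = sum-tabulate-indicator a

sum-tabulate-≤ : ∀ {r p} (g : Fin r → ℕ) → (∀ j → g j ≤ p) → sum (List.tabulate g) ≤ r ℕ.* p
sum-tabulate-≤ {zero}  g g≤p = z≤n
sum-tabulate-≤ {suc r} g g≤p = ℕ.+-mono-≤ (g≤p zero) (sum-tabulate-≤ (g ∘ suc) (g≤p ∘ suc))

length-filter-∷ : ∀ {a p} {A : Set a} {P : A → Set p} (P? : ∀ x → Dec (P x)) x xs →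
  length (filter P? (x ∷ xs)) ≡ (if does (P? x) then 1 else 0) ℕ.+ length (filter P? xs)
length-filter-∷ P? x xs with does (P? x)
... | true  = ≡.refl
... | false = ≡.refl

sum-length-fibres : ∀ {a r} {A : Set a} (f : A → Fin r) (xs : List A) →
  sum (List.tabulate λ j → length (filter (λ i → f i Fin.≟ j) xs)) ≡ length xs
sum-length-fibres {r = r} f []       = sum-tabulate-zero r
sum-length-fibres          f (x ∷ xs) = begin
  sum (List.tabulate λ j → length (filter (λ i → f i Fin.≟ j) (x ∷ xs)))
    ≡⟨ ≡.cong sum (List.tabulate-cong λ j → length-filter-∷ (λ i → f i Fin.≟ j) x xs) ⟩
  sum (List.tabulate λ j → δ j ℕ.+ count j)   ≡⟨ sum-tabulate-+ δ count ⟩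
  sum (List.tabulate δ) ℕ.+ sum (List.tabulate count)
    ≡⟨ ≡.cong₂ ℕ._+_ (sum-tabulate-indicator (f x)) (sum-length-fibres f xs) ⟩
  suc (length xs) ∎
  where
  open ≡-Reasoning
  δ count : Fin _ → ℕ
  δ j     = if does (f x Fin.≟ j) then 1 else 0
  count j = length (filter (λ i → f i Fin.≟ j) xs)

pigeonhole : ∀ {n r} p (f : Fin n → Fin r) → r ℕ.* p < n → ∃ λ j → p < length (fibre f j)
pigeonhole {n} {r} p f r*p<n with Fin.any? (λ j → p ℕ.<? length (fibre f j))
... | yes found = found
... | no  none  = ⊥-elim (ℕ.<⇒≱ r*p<n n≤r*p)
  where
  n≤r*p : n ≤ r ℕ.* p
  n≤r*p = ≡.subst (_≤ r ℕ.* p) (≡.trans (sum-length-fibres f (allFin n)) (List.length-tabulate {n = n} (λ i → i)))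
                (sum-tabulate-≤ _ λ j → ℕ.≮⇒≥ (none ∘ (j ,_)))

mix : ∀ {a m} {A : Set a} → (Fin m → Bool) → (Fin m → A) → (Fin m → A) → Fin m → A
mix Q y y' k = if Q k then y' k else y k

sel-cong : ∀ {a d} {A : Set a} (S : Vec Bool d) {x x' : Fin d → A} →
  (∀ k → Vec.lookup S k ≡ true → x k ≡ x' k) → sel S x ≡ sel S x'
sel-cong []          agree = ≡.refl
sel-cong (true ∷ S)  agree = ≡.cong₂ Vector._∷_ (agree zero ≡.refl) (sel-cong S (agree ∘ suc))
sel-cong (false ∷ S) agree = sel-cong S (agree ∘ suc)

∃-lookup-true : ∀ {d} (S : Vec Bool d) → 1 ≤ size S → ∃ λ k → Vec.lookup S k ≡ true
∃-lookup-true (true ∷ S)  _        = zero , ≡.refl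
∃-lookup-true (false ∷ S) 1≤|S| with ∃-lookup-true S 1≤|S|
... | k , S[k]≡true = suc k , S[k]≡true

module _ {c ℓ : Level} (F : Field c ℓ) where
  open Field F hiding (zero)
  open CommutativeSemigroupProperties +-commutativeSemigroup using () renaming (interchange to +-interchange)
  open CommutativeSemigroupProperties *-commutativeSemigroup using (x∙yz≈y∙xz) renaming (interchange to *-interchange)
  open import Algebra.Properties.Ring ring using (-‿involutive; -0#≈0#; -1*x≈-x; -‿distribʳ-*; -‿distribˡ-*)
  open import Relation.Binary.Reasoning.Setoid setoid
  open import Algebra.Solver.Ring.NaturalCoefficients.Default commutativeSemiring

  ∑ : ∀ {a} {A : Set a} → List A → (A → Carrier) → Carrier
  ∑ xs g = sumL F (List.map g xs)

  ∏ : ∀ {a} {A : Set a} → List A → (A → Carrier) → Carrier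
  ∏ xs g = prodL F (List.map g xs)

  module _ {a} {A : Set a} where

    ∑-cong : ∀ (xs : List A) {g h} → (∀ x → g x ≈ h x) → ∑ xs g ≈ ∑ xs h
    ∑-cong []       g≈h = refl
    ∑-cong (x ∷ xs) g≈h = +-cong (g≈h x) (∑-cong xs g≈h)

    ∏-cong : ∀ (xs : List A) {g h} → (∀ x → g x ≈ h x) → ∏ xs g ≈ ∏ xs h
    ∏-cong []       g≈h = refl
    ∏-cong (x ∷ xs) g≈h = *-cong (g≈h x) (∏-cong xs g≈h)

    ∑-distrib-+ : ∀ (xs : List A) g h → ∑ xs (λ x → g x + h x) ≈ ∑ xs g + ∑ xs h
    ∑-distrib-+ []       g h = sym (+-identityˡ 0#)
    ∑-distrib-+ (x ∷ xs) g h = trans (+-congˡ (∑-distrib-+ xs g h)) (+-interchange _ _ _ _)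

    ∏-distrib-* : ∀ (xs : List A) g h → ∏ xs (λ x → g x * h x) ≈ ∏ xs g * ∏ xs h
    ∏-distrib-* []       g h = sym (*-identityˡ 1#)
    ∏-distrib-* (x ∷ xs) g h = trans (*-congˡ (∏-distrib-* xs g h)) (*-interchange _ _ _ _)

    *-distribˡ-∑ : ∀ (xs : List A) a g → a * ∑ xs g ≈ ∑ xs (λ x → a * g x)
    *-distribˡ-∑ []       a g = zeroʳ a
    *-distribˡ-∑ (x ∷ xs) a g = trans (distribˡ a (g x) (∑ xs g)) (+-congˡ (*-distribˡ-∑ xs a g))

    ∑-cong-∈ : ∀ (xs : List A) {g h} → (∀ {x} → x ∈ xs → g x ≈ h x) → ∑ xs g ≈ ∑ xs h
    ∑-cong-∈ []       g≈h = refl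
    ∑-cong-∈ (x ∷ xs) g≈h = +-cong (g≈h (here ≡.refl)) (∑-cong-∈ xs (g≈h ∘ there))

    ∑-zero : ∀ (xs : List A) {g} → (∀ {x} → x ∈ xs → g x ≈ 0#) → ∑ xs g ≈ 0#
    ∑-zero []       g≈0 = refl
    ∑-zero (x ∷ xs) g≈0 = trans (+-cong (g≈0 (here ≡.refl)) (∑-zero xs (g≈0 ∘ there))) (+-identityˡ 0#)

    ∑-single : ∀ {xs : List A} → Unique xs → ∀ {c} → c ∈ xs → (g : A → Carrier) →
      (∀ {x} → x ∈ xs → x ≢ c → g x ≈ 0#) → ∑ xs g ≈ g c
    ∑-single (x∉xs ∷ _) (here ≡.refl) g g≈0 =
      trans (+-congˡ (∑-zero _ λ x∈ → g≈0 (there x∈) λ { ≡.refl → All.lookup x∉xs x∈ ≡.refl })) (+-identityʳ _)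
    ∑-single (x∉xs ∷ unique) (there c∈) g g≈0 =
      trans (+-congʳ (g≈0 (here ≡.refl) λ { ≡.refl → All.lookup x∉xs c∈ ≡.refl }))
            (trans (+-identityˡ _) (∑-single unique c∈ g (g≈0 ∘ there)))

    ∏-zero : ∀ {xs : List A} {g x} → x ∈ xs → g x ≈ 0# → ∏ xs g ≈ 0#
    ∏-zero (here ≡.refl) gx≈0 = trans (*-congʳ gx≈0) (zeroˡ _)
    ∏-zero (there x∈)   gx≈0 = trans (*-congˡ (∏-zero x∈ gx≈0)) (zeroʳ _)

    ∑-++ : ∀ (xs ys : List A) g → ∑ (xs ++ ys) g ≈ ∑ xs g + ∑ ys g
    ∑-++ []       ys g = sym (+-identityˡ _)
    ∑-++ (x ∷ xs) ys g = trans (+-congˡ (∑-++ xs ys g)) (sym (+-assoc _ _ _))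

    ∑-const : ∀ (xs : List A) z → ∑ xs (λ _ → z) ≈ ι F (List.length xs) * z
    ∑-const []       z = sym (zeroˡ z)
    ∑-const (x ∷ xs) z = trans (+-cong (sym (*-identityˡ z)) (∑-const xs z)) (sym (distribʳ z 1# _))

  module _ {a b} {A : Set a} {B : Set b} where

    ∑-concatMap : ∀ (k : A → List B) (xs : List A) g → ∑ (concatMap k xs) g ≈ ∑ xs (λ x → ∑ (k x) g)
    ∑-concatMap k []       g = refl
    ∑-concatMap k (x ∷ xs) g = trans (∑-++ (k x) (concatMap k xs) g) (+-congˡ (∑-concatMap k xs g))

    ∑-comm : ∀ (xs : List A) (ys : List B) (g : A → B → Carrier) →
      ∑ xs (λ x → ∑ ys (g x)) ≈ ∑ ys (λ y → ∑ xs (λ x → g x y))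
    ∑-comm []       ys g = sym (∑-zero ys (λ _ → refl))
    ∑-comm (x ∷ xs) ys g = trans (+-congˡ (∑-comm xs ys g)) (sym (∑-distrib-+ ys (g x) _))

  ∏-allFin-suc : ∀ n (g : Fin (suc n) → Carrier) → ∏ (allFin (suc n)) g ≡ g zero * ∏ (allFin n) (g ∘ suc)
  ∏-allFin-suc n g = ≡.cong (λ l → g zero * prodL F l)
    (≡.trans (List.map-tabulate suc g) (≡.sym (List.map-tabulate id (g ∘ suc))))

  without : ∀ {n} → Fin n → (Fin n → Carrier) → Fin n → Carrier
  without a g i = if does (i Fin.≟ a) then 1# else g i

  ∏-extract : ∀ n (g : Fin n → Carrier) a → ∏ (allFin n) g ≈ g a * ∏ (allFin n) (without a g)
  ∏-extract (suc n) g zero = begin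
    ∏ (allFin (suc n)) g                   ≡⟨ ∏-allFin-suc n g ⟩
    g zero * ∏ (allFin n) (g ∘ suc)        ≈⟨ *-congˡ (sym (*-identityˡ _)) ⟩
    g zero * (1# * ∏ (allFin n) (g ∘ suc)) ≡⟨ ≡.cong (g zero *_) (≡.sym (∏-allFin-suc n (without zero g))) ⟩
    g zero * ∏ (allFin (suc n)) (without zero g) ∎
  ∏-extract (suc n) g (suc a) = begin
    ∏ (allFin (suc n)) g                                              ≡⟨ ∏-allFin-suc n g ⟩
    g zero * ∏ (allFin n) (g ∘ suc)                                   ≈⟨ *-congˡ (∏-extract n (g ∘ suc) a) ⟩
    g zero * (g (suc a) * ∏ (allFin n) (without a (g ∘ suc)))         ≈⟨ x∙yz≈y∙xz _ _ _ ⟩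
    g (suc a) * (g zero * ∏ (allFin n) (without a (g ∘ suc)))
      ≡⟨ ≡.cong (g (suc a) *_) (≡.sym (∏-allFin-suc n (without (suc a) g))) ⟩
    g (suc a) * ∏ (allFin (suc n)) (without (suc a) g) ∎

  ∏-agree-off-pair : ∀ n (g g' : Fin n → Carrier) {a b} → a ≢ b →
    (∀ {i} → i ≢ a → i ≢ b → g i ≈ g' i) → g a * g b ≈ g' a * g' b → ∏ (allFin n) g ≈ ∏ (allFin n) g'
  ∏-agree-off-pair n g g' {a} {b} a≢b g≈g' gab≈g'ab = begin
    ∏ (allFin n) g                                       ≈⟨ extract-pair g ⟩
    (g a * g b) * ∏ (allFin n) (without b (without a g))    ≈⟨ *-cong gab≈g'ab (∏-cong (allFin n) rest) ⟩
    (g' a * g' b) * ∏ (allFin n) (without b (without a g')) ≈⟨ sym (extract-pair g') ⟩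
    ∏ (allFin n) g' ∎
    where
    extract-pair : ∀ h → ∏ (allFin n) h ≈ (h a * h b) * ∏ (allFin n) (without b (without a h))
    extract-pair h = begin
      ∏ (allFin n) h                                                   ≈⟨ ∏-extract n h a ⟩
      h a * ∏ (allFin n) (without a h)                                 ≈⟨ *-congˡ (∏-extract n (without a h) b) ⟩
      h a * (without a h b * ∏ (allFin n) (without b (without a h)))
        ≡⟨ ≡.cong (λ z → h a * ((if z then 1# else h b) * ∏ (allFin n) (without b (without a h))))
                  (dec-false (b Fin.≟ a) (a≢b ∘ ≡.sym)) ⟩
      h a * (h b * ∏ (allFin n) (without b (without a h)))             ≈⟨ sym (*-assoc _ _ _) ⟩
      (h a * h b) * ∏ (allFin n) (without b (without a h)) ∎
    rest : ∀ i → without b (without a g) i ≈ without b (without a g') i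
    rest i with i Fin.≟ b
    ... | yes _ = refl
    ... | no i≢b with i Fin.≟ a
    ...   | yes _  = refl
    ...   | no i≢a = g≈g' i≢a i≢b

  ∑Fun : ∀ {a} {A : Set a} m → List A → ((Fin m → A) → Carrier) → Carrier
  ∑Fun m xs G = ∑ (allFuns m xs) G

  -- Without function extensionality, sums over maps are only invariant under reindexings
  -- for summands that respect pointwise equality.
  Extensional : ∀ {a} {A : Set a} {m} → ((Fin m → A) → Carrier) → Set (a ⊔ ℓ)
  Extensional G = ∀ {f g} → f ≗ g → G f ≈ G g

  module _ {a} {A : Set a} where

    ∑Fun-cong : ∀ m (xs : List A) {G H} → (∀ f → G f ≈ H f) → ∑Fun m xs G ≈ ∑Fun m xs H
    ∑Fun-cong m xs = ∑-cong (allFuns m xs)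

    ∑Fun-suc : ∀ m (xs : List A) G → ∑Fun (suc m) xs G ≈ ∑ xs (λ x → ∑Fun m xs (λ f → G (x Vector.∷ f)))
    ∑Fun-suc m xs G = trans (∑-concatMap (λ x → List.map (x Vector.∷_) (allFuns m xs)) xs G)
      (∑-cong xs λ x → reflexive (≡.cong (sumL F) (≡.sym (List.map-∘ (allFuns m xs)))))

    ∏-∑ : ∀ n (xs : List A) (g : Fin n → A → Carrier) →
      ∏ (allFin n) (λ i → ∑ xs (g i)) ≈ ∑Fun n xs (λ f → ∏ (allFin n) (λ i → g i (f i)))
    ∏-∑ zero    xs g = sym (+-identityʳ 1#)
    ∏-∑ (suc n) xs g = begin
      ∏ (allFin (suc n)) (λ i → ∑ xs (g i))                         ≡⟨ ∏-allFin-suc n _ ⟩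
      ∑ xs (g zero) * ∏ (allFin n) (λ i → ∑ xs (g (suc i)))         ≈⟨ *-congˡ (∏-∑ n xs (g ∘ suc)) ⟩
      ∑ xs (g zero) * ∑Fun n xs (λ f → ∏ (allFin n) (λ i → g (suc i) (f i)))  ≈⟨ *-comm _ _ ⟩
      ∑Fun n xs (λ f → ∏ (allFin n) (λ i → g (suc i) (f i))) * ∑ xs (g zero)
        ≈⟨ *-distribˡ-∑ xs _ (g zero) ⟩
      ∑ xs (λ x → ∑Fun n xs (λ f → ∏ (allFin n) (λ i → g (suc i) (f i))) * g zero x)
        ≈⟨ ∑-cong xs (λ x → trans (*-comm _ _) (*-distribˡ-∑ (allFuns n xs) (g zero x) _)) ⟩
      ∑ xs (λ x → ∑Fun n xs (λ f → g zero x * ∏ (allFin n) (λ i → g (suc i) (f i))))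
        ≈⟨ ∑-cong xs (λ x → ∑Fun-cong n xs λ f →
             reflexive (≡.sym (∏-allFin-suc n (λ i → g i ((x Vector.∷ f) i))))) ⟩
      ∑ xs (λ x → ∑Fun n xs (λ f → ∏ (allFin (suc n)) (λ i → g i ((x Vector.∷ f) i))))
        ≈⟨ sym (∑Fun-suc n xs _) ⟩
      ∑Fun (suc n) xs (λ f → ∏ (allFin (suc n)) (λ i → g i (f i))) ∎

    ∑Fun-swapAdjacent : ∀ n t (xs : List A) G → Extensional G → ∑Fun n xs G ≈ ∑Fun n xs (λ h → G (h ∘ swapAdjacent t))
    ∑Fun-swapAdjacent zero          t       xs G ext = refl
    ∑Fun-swapAdjacent (suc zero)    t       xs G ext = refl
    ∑Fun-swapAdjacent (suc (suc n)) zero    xs G ext = begin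
      ∑Fun (suc (suc n)) xs G                                               ≈⟨ ∑Fun-suc (suc n) xs G ⟩
      ∑ xs (λ x → ∑Fun (suc n) xs (λ f → G (x Vector.∷ f)))               ≈⟨ ∑-cong xs (λ x → ∑Fun-suc n xs _) ⟩
      ∑ xs (λ x → ∑ xs (λ y → ∑Fun n xs (λ f → G (x Vector.∷ y Vector.∷ f)))) ≈⟨ ∑-comm xs xs _ ⟩
      ∑ xs (λ y → ∑ xs (λ x → ∑Fun n xs (λ f → G (x Vector.∷ y Vector.∷ f))))
        ≈⟨ ∑-cong xs (λ y → ∑-cong xs (λ x → ∑Fun-cong n xs (λ f →
             ext λ { zero → ≡.refl ; (suc zero) → ≡.refl ; (suc (suc i)) → ≡.refl }))) ⟩
      ∑ xs (λ y → ∑ xs (λ x → ∑Fun n xs (λ f → G ((y Vector.∷ x Vector.∷ f) ∘ swapAdjacent zero))))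
        ≈⟨ sym (∑-cong xs (λ y → ∑Fun-suc n xs _)) ⟩
      ∑ xs (λ y → ∑Fun (suc n) xs (λ f → G ((y Vector.∷ f) ∘ swapAdjacent zero))) ≈⟨ sym (∑Fun-suc (suc n) xs _) ⟩
      ∑Fun (suc (suc n)) xs (λ h → G (h ∘ swapAdjacent zero)) ∎
    ∑Fun-swapAdjacent (suc (suc n)) (suc t) xs G ext = begin
      ∑Fun (suc (suc n)) xs G                                 ≈⟨ ∑Fun-suc (suc n) xs G ⟩
      ∑ xs (λ x → ∑Fun (suc n) xs (λ f → G (x Vector.∷ f)))
        ≈⟨ ∑-cong xs (λ x → ∑Fun-swapAdjacent (suc n) t xs _ λ f≗g → ext λ { zero → ≡.refl ; (suc i) → f≗g i }) ⟩
      ∑ xs (λ x → ∑Fun (suc n) xs (λ f → G (x Vector.∷ (f ∘ swapAdjacent t))))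
        ≈⟨ ∑-cong xs (λ x → ∑Fun-cong (suc n) xs λ f → ext λ { zero → ≡.refl ; (suc i) → ≡.refl }) ⟩
      ∑ xs (λ x → ∑Fun (suc n) xs (λ f → G ((x Vector.∷ f) ∘ swapAdjacent (suc t))))
        ≈⟨ sym (∑Fun-suc (suc n) xs _) ⟩
      ∑Fun (suc (suc n)) xs (λ h → G (h ∘ swapAdjacent (suc t))) ∎

    ∑Fun-transposeAt : ∀ n a k (xs : List A) G → Extensional G →
      ∑Fun n xs G ≈ ∑Fun n xs (λ h → G (h ∘ transposeAt a k))
    ∑Fun-transposeAt n a zero    xs G ext = ∑Fun-swapAdjacent n a xs G ext
    ∑Fun-transposeAt n a (suc k) xs G ext = begin
      ∑Fun n xs G                                               ≈⟨ ∑Fun-swapAdjacent n t xs G ext ⟩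
      ∑Fun n xs (λ h → G (h ∘ swapAdjacent t))
        ≈⟨ ∑Fun-transposeAt n a k xs _ (λ f≗g → ext (f≗g ∘ swapAdjacent t)) ⟩
      ∑Fun n xs (λ h → G (h ∘ transposeAt a k ∘ swapAdjacent t))
        ≈⟨ ∑Fun-swapAdjacent n t xs _ (λ f≗g → ext (f≗g ∘ transposeAt a k ∘ swapAdjacent t)) ⟩
      ∑Fun n xs (λ h → G (h ∘ transposeAt a (suc k))) ∎
      where t = a ℕ.+ suc k

  -- sgn F, generalised to maps into Fin k so that it can be unfolded along the domain.
  sign : ∀ {n k} → (Fin n → Fin k) → Carrier
  sign {n} σ = ∏ (allFin n) λ i → ∏ (allFin n) λ j →
    if toℕ i <ᵇ toℕ j then pairSign F (σ i) (σ j) else 1#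

  sign-cong : ∀ {n k} {σ σ' : Fin n → Fin k} → σ ≗ σ' → sign σ ≈ sign σ'
  sign-cong {n} σ≗σ' = ∏-cong (allFin n) λ i → ∏-cong (allFin n) λ j →
    reflexive (≡.cong (λ z → if toℕ i <ᵇ toℕ j then z else 1#) (≡.cong₂ (pairSign F) (σ≗σ' i) (σ≗σ' j)))

  sign-suc : ∀ {k} n (σ : Fin (suc n) → Fin k) →
    sign σ ≈ ∏ (allFin n) (λ j → pairSign F (σ zero) (σ (suc j))) * sign (σ ∘ suc)
  sign-suc n σ = begin
    sign σ
      ≡⟨ ≡.trans (∏-allFin-suc n _) (≡.cong₂ _*_ (∏-allFin-suc n _)
                  (≡.cong (prodL F) (List.map-cong (λ i → ∏-allFin-suc n (inversion (suc i))) (allFin n)))) ⟩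
    (1# * ∏ (allFin n) (λ j → pairSign F (σ zero) (σ (suc j))))
      * ∏ (allFin n) (λ i → 1# * ∏ (allFin n) (inversion (suc i) ∘ suc))
      ≈⟨ *-cong (*-identityˡ _) (∏-cong (allFin n) (λ i → *-identityˡ _)) ⟩
    ∏ (allFin n) (λ j → pairSign F (σ zero) (σ (suc j))) * sign (σ ∘ suc) ∎
    where
    inversion : Fin (suc n) → Fin (suc n) → Carrier
    inversion i j = if toℕ i <ᵇ toℕ j then pairSign F (σ i) (σ j) else 1#

  pairSign-≡ : ∀ {k} {x y : Fin k} → x ≡ y → pairSign F x y ≈ 0#
  pairSign-≡ {x = x} ≡.refl with toℕ x <ᵇ toℕ x in x<x
  ... | true  = ⊥-elim (ℕ.<-irrefl ≡.refl (ℕ.<ᵇ⇒< (toℕ x) (toℕ x) (≡.subst T (≡.sym x<x) _)))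
  ... | false = refl

  pairSign-antisym : ∀ {k} (x y : Fin k) → pairSign F y x ≈ - pairSign F x y
  pairSign-antisym x y with toℕ x <ᵇ toℕ y in x<y | toℕ y <ᵇ toℕ x in y<x
  ... | true  | true  = ⊥-elim (ℕ.<-asym (ℕ.<ᵇ⇒< (toℕ x) (toℕ y) (≡.subst T (≡.sym x<y) _))
                                         (ℕ.<ᵇ⇒< (toℕ y) (toℕ x) (≡.subst T (≡.sym y<x) _)))
  ... | true  | false = refl
  ... | false | true  = sym (-‿involutive 1#)
  ... | false | false = sym -0#≈0#

  ∏-swapAdjacent : ∀ n t (g : Fin n → Carrier) → ∏ (allFin n) (g ∘ swapAdjacent t) ≈ ∏ (allFin n) g
  ∏-swapAdjacent zero          t       g = refl
  ∏-swapAdjacent (suc zero)    t       g = refl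
  ∏-swapAdjacent (suc (suc n)) zero    g = begin
    ∏ (allFin (suc (suc n))) (g ∘ swapAdjacent zero)
      ≡⟨ ≡.trans (∏-allFin-suc (suc n) (g ∘ swapAdjacent zero))
                 (≡.cong (g (suc zero) *_) (∏-allFin-suc n (g ∘ swapAdjacent zero ∘ suc))) ⟩
    g (suc zero) * (g zero * ∏ (allFin n) (λ i → g (suc (suc i))))  ≈⟨ x∙yz≈y∙xz _ _ _ ⟩
    g zero * (g (suc zero) * ∏ (allFin n) (λ i → g (suc (suc i))))
      ≡⟨ ≡.sym (≡.trans (∏-allFin-suc (suc n) g) (≡.cong (g zero *_) (∏-allFin-suc n (g ∘ suc)))) ⟩
    ∏ (allFin (suc (suc n))) g ∎
  ∏-swapAdjacent (suc (suc n)) (suc t) g = begin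
    ∏ (allFin (suc (suc n))) (g ∘ swapAdjacent (suc t))    ≡⟨ ∏-allFin-suc (suc n) (g ∘ swapAdjacent (suc t)) ⟩
    g zero * ∏ (allFin (suc n)) (g ∘ suc ∘ swapAdjacent t) ≈⟨ *-congˡ (∏-swapAdjacent (suc n) t (g ∘ suc)) ⟩
    g zero * ∏ (allFin (suc n)) (g ∘ suc)                  ≡⟨ ≡.sym (∏-allFin-suc (suc n) g) ⟩
    ∏ (allFin (suc (suc n))) g ∎

  sign-swapAdjacent : ∀ {k} n t → suc t < n → (σ : Fin n → Fin k) → sign (σ ∘ swapAdjacent t) ≈ - sign σ
  sign-swapAdjacent (suc zero)    zero (s≤s ()) σ
  sign-swapAdjacent (suc (suc n)) zero _ σ = begin
    sign (σ ∘ swapAdjacent zero)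
      ≈⟨ sign-suc (suc n) (σ ∘ swapAdjacent zero) ⟩
    ∏ (allFin (suc n)) (λ j → pairSign F (σ (suc zero)) (σ (swapAdjacent zero (suc j))))
      * sign (λ i → σ (swapAdjacent zero (suc i)))
      ≈⟨ *-cong (reflexive (∏-allFin-suc n (λ j → pairSign F (σ (suc zero)) (σ (swapAdjacent zero (suc j))))))
                (sign-suc n (λ i → σ (swapAdjacent zero (suc i)))) ⟩
    (pairSign F (σ (suc zero)) (σ zero) * P₁) * (P₀ * S)
      ≈⟨ *-congʳ (*-congʳ (pairSign-antisym (σ zero) (σ (suc zero)))) ⟩
    ((- pairSign F (σ zero) (σ (suc zero))) * P₁) * (P₀ * S)
      ≈⟨ trans (*-congʳ (sym (-‿distribˡ-* _ _))) (sym (-‿distribˡ-* _ _)) ⟩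
    - ((pairSign F (σ zero) (σ (suc zero)) * P₁) * (P₀ * S))
      ≈⟨ -‿cong (solve 4 (λ x P₁ P₀ S → (x :* P₁) :* (P₀ :* S) := (x :* P₀) :* (P₁ :* S)) refl _ _ _ _) ⟩
    - ((pairSign F (σ zero) (σ (suc zero)) * P₀) * (P₁ * S))
      ≈⟨ -‿cong (sym (*-cong (reflexive (∏-allFin-suc n (λ j → pairSign F (σ zero) (σ (suc j)))))
                              (sign-suc n (σ ∘ suc)))) ⟩
    - (∏ (allFin (suc n)) (λ j → pairSign F (σ zero) (σ (suc j))) * sign (σ ∘ suc))
      ≈⟨ -‿cong (sym (sign-suc (suc n) σ)) ⟩
    - sign σ ∎
    where
    P₀ = ∏ (allFin n) (λ j → pairSign F (σ zero) (σ (suc (suc j))))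
    P₁ = ∏ (allFin n) (λ j → pairSign F (σ (suc zero)) (σ (suc (suc j))))
    S  = sign (λ i → σ (suc (suc i)))
  sign-swapAdjacent (suc (suc n)) (suc t) (s≤s 1+t<n) σ = begin
    sign (σ ∘ swapAdjacent (suc t))
      ≈⟨ sign-suc (suc n) (σ ∘ swapAdjacent (suc t)) ⟩
    ∏ (allFin (suc n)) (λ j → pairSign F (σ zero) (σ (suc (swapAdjacent t j)))) * sign (λ i → σ (suc (swapAdjacent t i)))
      ≈⟨ *-cong (∏-swapAdjacent (suc n) t (λ j → pairSign F (σ zero) (σ (suc j))))
                (sign-swapAdjacent (suc n) t 1+t<n (σ ∘ suc)) ⟩
    ∏ (allFin (suc n)) (λ j → pairSign F (σ zero) (σ (suc j))) * (- sign (σ ∘ suc))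
      ≈⟨ sym (-‿distribʳ-* _ _) ⟩
    - (∏ (allFin (suc n)) (λ j → pairSign F (σ zero) (σ (suc j))) * sign (σ ∘ suc))
      ≈⟨ -‿cong (sym (sign-suc (suc n) σ)) ⟩
    - sign σ ∎

  sign-transposeAt : ∀ {k} n a j → a ℕ.+ suc j < n → (σ : Fin n → Fin k) → sign (σ ∘ transposeAt a j) ≈ - sign σ
  sign-transposeAt n a zero    lt σ = sign-swapAdjacent n a (≡.subst (_< n) (ℕ.+-comm a 1) lt) σ
  sign-transposeAt n a (suc j) lt σ = begin
    sign (σ ∘ swapAdjacent t ∘ transposeAt a j ∘ swapAdjacent t)
      ≈⟨ sign-swapAdjacent n t 1+t<n (σ ∘ swapAdjacent t ∘ transposeAt a j) ⟩
    - sign (σ ∘ swapAdjacent t ∘ transposeAt a j)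
      ≈⟨ -‿cong (sign-transposeAt n a j (ℕ.<-trans (ℕ.n<1+n t) 1+t<n) (σ ∘ swapAdjacent t)) ⟩
    - - sign (σ ∘ swapAdjacent t)                                  ≈⟨ -‿involutive _ ⟩
    sign (σ ∘ swapAdjacent t)                                      ≈⟨ sign-swapAdjacent n t 1+t<n σ ⟩
    - sign σ ∎
    where
    t = a ℕ.+ suc j
    1+t<n : suc t < n
    1+t<n = ≡.subst (_< n) (ℕ.+-suc a (suc j)) lt

  sign-nonInjective : ∀ {k} n (σ : Fin n → Fin k) {a b} → a ≢ b → σ a ≡ σ b → sign σ ≈ 0#
  sign-nonInjective (suc n) σ {zero}  {zero}  a≢b _ = ⊥-elim (a≢b ≡.refl)
  sign-nonInjective (suc n) σ {zero}  {suc b} _ σa≡σb = trans (sign-suc n σ)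
    (trans (*-congʳ (∏-zero (∈-allFin b) (pairSign-≡ σa≡σb))) (zeroˡ _))
  sign-nonInjective (suc n) σ {suc a} {zero}  _ σa≡σb = trans (sign-suc n σ)
    (trans (*-congʳ (∏-zero (∈-allFin a) (pairSign-≡ (≡.sym σa≡σb)))) (zeroˡ _))
  sign-nonInjective (suc n) σ {suc a} {suc b} a≢b σa≡σb = trans (sign-suc n σ)
    (trans (*-congˡ (sign-nonInjective n (σ ∘ suc) (a≢b ∘ ≡.cong suc) σa≡σb)) (zeroʳ _))

  record Transposition {n} (a b : Fin n) : Set (c ⊔ ℓ) where
    field
      τ               : Fin n → Fin n
      isTransposition : IsTransposition τ a b
      sign-∘τ         : ∀ {k} (σ : Fin n → Fin k) → sign (σ ∘ τ) ≈ - sign σ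
      ∑Fun-∘τ         : ∀ G → Extensional G → ∑Fun n (allFin n) G ≈ ∑Fun n (allFin n) (λ h → G (h ∘ τ))
    open IsTransposition isTransposition public

  transposition< : ∀ {n} {a b : Fin n} → a Fin.< b → Transposition a b
  transposition< {n} {a} {b} a<b = record
    { τ               = transposeAt (toℕ a) k
    ; isTransposition = isTransposition-transposeAt a<b
    ; sign-∘τ         = sign-transposeAt n (toℕ a) k b′<n
    ; ∑Fun-∘τ         = ∑Fun-transposeAt n (toℕ a) k (allFin n)
    }
    where
    k = toℕ b ∸ suc (toℕ a)
    b′<n : toℕ a ℕ.+ suc k < n
    b′<n = ≡.subst (_< n) (≡.sym (≡.trans (ℕ.+-suc (toℕ a) k) (ℕ.m+[n∸m]≡n a<b))) (Fin.toℕ<n b)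

  transposition : ∀ {n} {a b : Fin n} → a ≢ b → Transposition a b
  transposition {a = a} {b} a≢b with Fin.<-cmp a b
  ... | tri< a<b _ _ = transposition< a<b
  ... | tri≈ _ a≡b _ = ⊥-elim (a≢b a≡b)
  ... | tri> _ _ b<a = record
    { τ = τ ; isTransposition = isTransposition-sym isTransposition ; sign-∘τ = sign-∘τ ; ∑Fun-∘τ = ∑Fun-∘τ }
    where open Transposition (transposition< b<a)

  Extensional₂ : ∀ {m n} → ((Fin m → Fin n → Fin n) → Carrier) → Set ℓ
  Extensional₂ G = ∀ {σ σ'} → (∀ k → σ k ≗ σ' k) → G σ ≈ G σ'

  twist : ∀ {m n} → (Fin m → Bool) → (Fin n → Fin n) → (Fin m → Fin n → Fin n) → Fin m → Fin n → Fin n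
  twist Q τ σ k = if Q k then σ k ∘ τ else σ k

  ∑Fun-twist : ∀ m n (Q : Fin m → Bool) (τ : Fin n → Fin n) →
    (∀ H → Extensional H → ∑Fun n (allFin n) H ≈ ∑Fun n (allFin n) (λ h → H (h ∘ τ))) →
    ∀ G → Extensional₂ G → ∑Fun m (allMaps n) G ≈ ∑Fun m (allMaps n) (G ∘ twist Q τ)
  ∑Fun-twist zero    n Q τ ∑-∘τ G ext = +-congʳ (ext λ ())
  ∑Fun-twist (suc m) n Q τ ∑-∘τ G ext = begin
    ∑Fun (suc m) L G                                          ≈⟨ ∑Fun-suc m L G ⟩
    ∑ L (λ x → K x)                                           ≈⟨ twist-head (Q zero) ⟩
    ∑ L (λ x → K (twist₀ x))
      ≈⟨ ∑-cong L (λ x → ∑Fun-twist m n (Q ∘ suc) τ ∑-∘τ _ λ σ≗σ' →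
           ext λ { zero _ → ≡.refl ; (suc k) → σ≗σ' k }) ⟩
    ∑ L (λ x → ∑Fun m L (λ σ → G (twist₀ x Vector.∷ twist (Q ∘ suc) τ σ)))
      ≈⟨ ∑-cong L (λ x → ∑Fun-cong m L λ σ → ext λ { zero _ → ≡.refl ; (suc k) _ → ≡.refl }) ⟩
    ∑ L (λ x → ∑Fun m L (λ σ → G (twist Q τ (x Vector.∷ σ))))  ≈⟨ sym (∑Fun-suc m L _) ⟩
    ∑Fun (suc m) L (G ∘ twist Q τ) ∎
    where
    L = allMaps n
    K : (Fin n → Fin n) → Carrier
    K x = ∑Fun m L (λ σ → G (x Vector.∷ σ))
    twist₀ : (Fin n → Fin n) → Fin n → Fin n
    twist₀ x = if Q zero then x ∘ τ else x
    twist-head : ∀ b → ∑ L K ≈ ∑ L (λ x → K (if b then x ∘ τ else x))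
    twist-head true  = ∑-∘τ K λ x≗y → ∑Fun-cong m L λ σ → ext λ { zero → x≗y ; (suc k) _ → ≡.refl }
    twist-head false = refl

  when : ∀ {p} {P : Set p} → Dec P → Carrier → Carrier
  when (yes _) x = x
  when (no _)  _ = 0#

  when-cong : ∀ {p q} {P : Set p} {P′ : Set q} (P? : Dec P) (P′? : Dec P′) → (P → P′) → (P′ → P) →
    ∀ {x y} → x ≈ y → when P? x ≈ when P′? y
  when-cong (yes _)  (yes _)  _    _    x≈y = x≈y
  when-cong (yes p)  (no ¬p′) p→p′ _    _   = ⊥-elim (¬p′ (p→p′ p))
  when-cong (no ¬p)  (yes p′) _    p′→p _   = ⊥-elim (¬p (p′→p p′))
  when-cong (no _)   (no _)   _    _    _   = refl

  when-zero : ∀ {p} {P : Set p} (P? : Dec P) {x} → x ≈ 0# → when P? x ≈ 0#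
  when-zero (yes _) x≈0 = x≈0
  when-zero (no _)  _   = refl

  when-*ˡ : ∀ {p} {P : Set p} (P? : Dec P) a x → when P? (a * x) ≈ a * when P? x
  when-*ˡ (yes _) a x = refl
  when-*ˡ (no _)  a x = sym (zeroʳ a)

  parity : ∀ {m} → (Fin m → Bool) → Carrier
  parity {m} Q = ∏ (allFin m) (λ k → if Q k then - 1# else 1#)

  parity-±1 : ∀ {a} {A : Set a} (ks : List A) (Q : A → Bool) →
    let ε = ∏ ks (λ k → if Q k then - 1# else 1#) in ε ≈ 1# ⊎ ε ≈ - 1#
  parity-±1 []       Q = inj₁ refl
  parity-±1 (k ∷ ks) Q with Q k | parity-±1 ks Q
  ... | true  | inj₁ ≈1  = inj₂ (trans (*-congˡ ≈1) (*-identityʳ _))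
  ... | true  | inj₂ ≈-1 = inj₁ (trans (*-congˡ ≈-1) (trans (-1*x≈-x _) (-‿involutive _)))
  ... | false | inj₁ ≈1  = inj₁ (trans (*-identityˡ _) ≈1)
  ... | false | inj₂ ≈-1 = inj₂ (trans (*-identityˡ _) ≈-1)

  term : ∀ {m n} → (Fin n → (Fin (suc m) → Fin n) → Carrier) → (Fin m → Fin n → Fin n) → Carrier
  term {m} {n} W σ = ∏ (allFin m) (λ k → sign (σ k)) * ∏ (allFin n) (λ i → W i (i Vector.∷ λ k → σ k i))

  module _ {m n} (W : Fin n → (Fin (suc m) → Fin n) → Carrier) (W-ext : ∀ i → Extensional (W i)) where

    ∷-cong : ∀ {k} (i : Fin n) {h h' : Fin k → Fin n} → h ≗ h' → (i Vector.∷ h) ≗ (i Vector.∷ h')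
    ∷-cong i h≗h' zero    = ≡.refl
    ∷-cong i h≗h' (suc k) = h≗h' k

    term-ext : Extensional₂ (term W)
    term-ext σ≗σ' = *-cong (∏-cong (allFin m) (λ k → sign-cong (σ≗σ' k)))
                           (∏-cong (allFin n) (λ i → W-ext i (∷-cong i (λ k → σ≗σ' k i))))

    Exchangeable : (Fin m → Bool) → Fin n → Fin n → Set ℓ
    Exchangeable Q a b = ∀ y y' →
      W a (a Vector.∷ y) * W b (b Vector.∷ y') ≈ W a (a Vector.∷ mix Q y y') * W b (b Vector.∷ mix Q y' y)

    -- Twisting moves the Q-coordinates of rows a and b past each other: each of the |Q|
    -- twisted sign factors flips, while the two affected row factors are exchanged.
    term-twist : ∀ Q {a b} → a ≢ b → Exchangeable Q a b → (T : Transposition a b) →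
      ∀ σ → term W (twist Q (Transposition.τ T) σ) ≈ parity Q * term W σ
    term-twist Q {a} {b} a≢b exchange T σ = begin
      ∏ (allFin m) (λ k → sign (twist Q τ σ k)) * ∏ (allFin n) row′
        ≈⟨ *-cong (∏-cong (allFin m) (λ k → sign-twist (Q k) (σ k)))
                  (∏-agree-off-pair n row′ row a≢b unswapped-rows swapped-rows) ⟩
      ∏ (allFin m) (λ k → (if Q k then - 1# else 1#) * sign (σ k)) * ∏ (allFin n) row
        ≈⟨ *-congʳ (∏-distrib-* (allFin m) _ _) ⟩
      (parity Q * ∏ (allFin m) (λ k → sign (σ k))) * ∏ (allFin n) row ≈⟨ *-assoc _ _ _ ⟩
      parity Q * term W σ ∎
      where
      open Transposition T
      row row′ : Fin n → Carrier
      row  i = W i (i Vector.∷ λ k → σ k i)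
      row′ i = W i (i Vector.∷ λ k → twist Q τ σ k i)
      sign-twist : ∀ q (s : Fin n → Fin n) → sign (if q then s ∘ τ else s) ≈ (if q then - 1# else 1#) * sign s
      sign-twist true  s = trans (sign-∘τ s) (sym (-1*x≈-x _))
      sign-twist false s = sym (*-identityˡ _)
      twist-fixes : ∀ q (s : Fin n → Fin n) {i} → τ i ≡ i → (if q then s ∘ τ else s) i ≡ s i
      twist-fixes true  s τi≡i = ≡.cong s τi≡i
      twist-fixes false s τi≡i = ≡.refl
      twist-at : ∀ q (s : Fin n → Fin n) {x y} → τ x ≡ y → (if q then s ∘ τ else s) x ≡ (if q then s y else s x)
      twist-at true  s τx≡y = ≡.cong s τx≡y
      twist-at false s τx≡y = ≡.refl
      unswapped-rows : ∀ {i} → i ≢ a → i ≢ b → row′ i ≈ row i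
      unswapped-rows i≢a i≢b = W-ext _ (∷-cong _ λ k → twist-fixes (Q k) (σ k) (fixes i≢a i≢b))
      swapped-rows : row′ a * row′ b ≈ row a * row b
      swapped-rows = trans (*-cong (W-ext a (∷-cong a λ k → twist-at (Q k) (σ k) image-left))
                                   (W-ext b (∷-cong b λ k → twist-at (Q k) (σ k) image-right)))
                           (sym (exchange (λ k → σ k a) (λ k → σ k b)))

    module _ (Q : Fin m → Bool) {k₀} (Q-k₀ : Q k₀ ≡ true) {j₀ : Fin n} {rest : List (Fin n)}
             (unique : Unique (j₀ ∷ rest)) (exchange : All.All (λ c → Exchangeable Q c j₀) rest) where

      private
        J = j₀ ∷ rest
        L = allMaps n

      argmaxPart : Fin n → (Fin m → Fin n → Fin n) → Carrier
      argmaxPart c σ = when (isArgmax? J (σ k₀) c) (term W σ)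

      argmaxPart-ext : ∀ c → Extensional₂ (argmaxPart c)
      argmaxPart-ext c {σ} {σ'} σ≗σ' = when-cong (isArgmax? J (σ k₀) c) (isArgmax? J (σ' k₀) c)
        (isArgmax-resp (σ≗σ' k₀)) (isArgmax-resp (≡.sym ∘ σ≗σ' k₀)) (term-ext σ≗σ')

      -- Unless σ k₀ collides on J (and then sign (σ k₀) = 0), exactly one row of J carries its maximum.
      term-split : ∀ σ → term W σ ≈ ∑ J (λ c → argmaxPart c σ)
      term-split σ with argmax-or-collision j₀ rest unique (σ k₀)
      ... | inj₁ (c , c∈J , max-c) = trans (sym (argmax-part max-c)) (sym (∑-single unique c∈J (λ c → argmaxPart c σ) others))
        where
        argmax-part : ∀ {c} → IsArgmax J (σ k₀) c → argmaxPart c σ ≈ term W σ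
        argmax-part {c} max with isArgmax? J (σ k₀) c
        ... | yes _   = refl
        ... | no ¬max = ⊥-elim (¬max max)
        others : ∀ {c'} → c' ∈ J → c' ≢ c → argmaxPart c' σ ≈ 0#
        others {c'} c'∈J c'≢c with isArgmax? J (σ k₀) c'
        ... | yes max-c' = ⊥-elim (c'≢c (isArgmax-unique c'∈J c∈J max-c' max-c))
        ... | no _       = refl
      ... | inj₂ (i , i' , _ , _ , i≢i' , collide) =
        trans term≈0 (sym (∑-zero J λ {c} _ → when-zero (isArgmax? J (σ k₀) c) term≈0))
        where
        term≈0 : term W σ ≈ 0#
        term≈0 = trans (*-congʳ (∏-zero (∈-allFin k₀) (sign-nonInjective n (σ k₀) i≢i' collide))) (zeroˡ _)

      ∑argmaxPart-transposed : ∀ {c} → c ∈ rest → ∑Fun m L (argmaxPart c) ≈ parity Q * ∑Fun m L (argmaxPart j₀)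
      ∑argmaxPart-transposed {c} c∈rest = begin
        ∑Fun m L (argmaxPart c)                         ≈⟨ ∑Fun-twist m n Q τ ∑Fun-∘τ (argmaxPart c) (argmaxPart-ext c) ⟩
        ∑Fun m L (argmaxPart c ∘ twist Q τ)             ≈⟨ ∑Fun-cong m L twisted-part ⟩
        ∑Fun m L (λ σ → parity Q * argmaxPart j₀ σ)
          ≈⟨ sym (*-distribˡ-∑ (allFuns m L) (parity Q) (argmaxPart j₀)) ⟩
        parity Q * ∑Fun m L (argmaxPart j₀) ∎
        where
        c≢j₀ : c ≢ j₀
        c≢j₀ c≡j₀ = All.lookup (AllPairs.head unique) c∈rest (≡.sym c≡j₀)
        τ-c-j₀ = transposition c≢j₀
        open Transposition τ-c-j₀
        twisted-part : ∀ σ → argmaxPart c (twist Q τ σ) ≈ parity Q * argmaxPart j₀ σ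
        twisted-part σ = trans
          (when-cong (isArgmax? J (twist Q τ σ k₀) c) (isArgmax? J (σ k₀) j₀)
             (proj₁ transposed ∘ isArgmax-resp twist-k₀) (isArgmax-resp (≡.sym ∘ twist-k₀) ∘ proj₂ transposed)
             (term-twist Q c≢j₀ (All.lookup exchange c∈rest) τ-c-j₀ σ))
          (when-*ˡ (isArgmax? J (σ k₀) j₀) (parity Q) (term W σ))
          where
          twist-k₀ : twist Q τ σ k₀ ≗ σ k₀ ∘ τ
          twist-k₀ i = ≡.cong (λ q → (if q then σ k₀ ∘ τ else σ k₀) i) Q-k₀
          transposed = isArgmax-transposed (σ k₀) isTransposition (there c∈rest) (here ≡.refl) c≢j₀

      ∑term-cancel : ∑Fun m L (term W) ≈
        ∑Fun m L (argmaxPart j₀) + ι F (List.length rest) * (parity Q * ∑Fun m L (argmaxPart j₀))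
      ∑term-cancel = begin
        ∑Fun m L (term W)                            ≈⟨ ∑Fun-cong m L term-split ⟩
        ∑Fun m L (λ σ → ∑ J (λ c → argmaxPart c σ))  ≈⟨ ∑-comm (allFuns m L) J (λ σ c → argmaxPart c σ) ⟩
        ∑Fun m L (argmaxPart j₀) + ∑ rest (λ c → ∑Fun m L (argmaxPart c))
          ≈⟨ +-congˡ (∑-cong-∈ rest ∑argmaxPart-transposed) ⟩
        ∑Fun m L (argmaxPart j₀) + ∑ rest (λ _ → parity Q * ∑Fun m L (argmaxPart j₀))
          ≈⟨ +-congˡ (∑-const rest _) ⟩
        ∑Fun m L (argmaxPart j₀) + ι F (List.length rest) * (parity Q * ∑Fun m L (argmaxPart j₀)) ∎

    module _ (Q : Fin m → Bool) {k₀} (Q-k₀ : Q k₀ ≡ true) {P : Fin n → Set}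
             (exchange : ∀ {c c'} → P c → P c' → Exchangeable Q c c') where

      ∑term-cancel-prefix : ∀ {J} → Unique J → All.All P J → ∀ q → q < List.length J →
        ∃ λ Y → ∑Fun m (allMaps n) (term W) ≈ Y + ι F q * (parity Q * Y)
      ∑term-cancel-prefix {j₀ ∷ rest} unique (P-j₀ ∷ P-rest) q (s≤s q≤|rest|) =
        Y , trans (∑term-cancel Q Q-k₀ unique′ exchange′)
                  (reflexive (≡.cong (λ l → Y + ι F l * (parity Q * Y)) |prefix|≡q))
        where
        unique′    = Unique.take⁺ (suc q) unique
        exchange′  = All.map (λ P-c → exchange P-c P-j₀) (All.take⁺ q P-rest)
        Y          = ∑Fun m (allMaps n) (argmaxPart Q Q-k₀ unique′ exchange′ j₀)
        |prefix|≡q = ≡.trans (List.length-take q rest) (ℕ.m≤n⇒m⊓n≡m q≤|rest|)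

      -- With parity 1, p + 2 rows give ι (p + 2) · Y = 0; with parity −1, two rows give Y − Y = 0.
      ∑term-vanishes : ∀ p → ι F (suc (suc p)) ≈ 0# →
        ∀ {J} → Unique J → All.All P J → suc (suc p) ≤ List.length J → ∑Fun m (allMaps n) (term W) ≈ 0#
      ∑term-vanishes p p≈0 unique P-J 2+p≤|J| with parity-±1 (allFin m) Q
      ... | inj₁ parity≈1 with ∑term-cancel-prefix unique P-J (suc p) 2+p≤|J|
      ...   | Y , cancel = begin
        _                                  ≈⟨ cancel ⟩
        Y + ι F (suc p) * (parity Q * Y)
          ≈⟨ +-cong (sym (*-identityˡ Y)) (*-congˡ (trans (*-congʳ parity≈1) (*-identityˡ Y))) ⟩
        1# * Y + ι F (suc p) * Y           ≈⟨ sym (distribʳ Y 1# _) ⟩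
        ι F (suc (suc p)) * Y              ≈⟨ *-congʳ p≈0 ⟩
        0# * Y                             ≈⟨ zeroˡ Y ⟩
        0# ∎
      ∑term-vanishes p p≈0 unique P-J 2+p≤|J| | inj₂ parity≈-1
        with ∑term-cancel-prefix unique P-J 1 (ℕ.≤-trans (s≤s (s≤s z≤n)) 2+p≤|J|)
      ...   | Y , cancel = begin
        _                                  ≈⟨ cancel ⟩
        Y + (1# + 0#) * (parity Q * Y)     ≈⟨ +-congˡ (trans (*-congʳ (+-identityʳ 1#)) (*-identityˡ _)) ⟩
        Y + parity Q * Y                   ≈⟨ +-congˡ (trans (*-congʳ parity≈-1) (-1*x≈-x Y)) ⟩
        Y - Y                              ≈⟨ -‿inverseʳ Y ⟩
        0# ∎

  -- Q marks the coordinates 2, …, d lying in the block that does not contain coordinate 1.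
  record Splitting {m n} (U : Tensor F (suc m) n) : Set (c ⊔ ℓ) where
    field
      Ũ        : (Fin (suc m) → Fin n) → Carrier
      Ũ-ext    : Extensional Ũ
      U≈Ũ      : ∀ x → U x ≈ Ũ x
      Q        : Fin m → Bool
      k₀       : Fin m
      Q-k₀     : Q k₀ ≡ true
      exchange : ∀ a b y y' →
        Ũ (a Vector.∷ y) * Ũ (b Vector.∷ y') ≈ Ũ (a Vector.∷ mix Q y y') * Ũ (b Vector.∷ mix Q y' y)

  module _ {m n} (R R̄ : Vec Bool m) (complement : ∀ k → Vec.lookup R̄ k ≡ not (Vec.lookup R k))
           (A : Tensor F (size (true ∷ R)) n) (B : Tensor F (size (false ∷ R̄)) n) where

    blockProduct : (Fin (suc m) → Fin n) → Carrier
    blockProduct x = A (sel (true ∷ R) x) * B (sel (false ∷ R̄) x)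

    blockProduct-ext : Extensional blockProduct
    blockProduct-ext x≗y = reflexive (≡.cong₂ _*_ (≡.cong A (sel-cong (true ∷ R) λ k _ → x≗y k))
                                             (≡.cong B (sel-cong (false ∷ R̄) λ k _ → x≗y k)))

    -- Swapping the R̄-coordinates of two rows leaves the A-factors alone and exchanges the B-factors.
    blockProduct-exchange : ∀ a b y y' →
      blockProduct (a Vector.∷ y) * blockProduct (b Vector.∷ y') ≈
      blockProduct (a Vector.∷ mix (Vec.lookup R̄) y y') * blockProduct (b Vector.∷ mix (Vec.lookup R̄) y' y)
    blockProduct-exchange a b y y' = trans
      (solve 4 (λ A₁ B₁ A₂ B₂ → (A₁ :* B₁) :* (A₂ :* B₂) := (A₁ :* B₂) :* (A₂ :* B₁)) refl _ _ _ _)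
      (sym (reflexive (≡.cong₂ _*_ (≡.cong₂ _*_ (≡.cong (λ z → A (a Vector.∷ z)) (mix-on-R y y')) (≡.cong B (mix-on-R̄ y y')))
                                   (≡.cong₂ _*_ (≡.cong (λ z → A (b Vector.∷ z)) (mix-on-R y' y)) (≡.cong B (mix-on-R̄ y' y))))))
      where
      mix-on-R : ∀ y y' → sel R (mix (Vec.lookup R̄) y y') ≡ sel R y
      mix-on-R y y' = sel-cong R λ k R[k] → ≡.cong (λ q → if q then y' k else y k) (≡.trans (complement k) (≡.cong not R[k]))
      mix-on-R̄ : ∀ y y' → sel R̄ (mix (Vec.lookup R̄) y y') ≡ sel R̄ y'
      mix-on-R̄ y y' = sel-cong R̄ λ k R̄[k] → ≡.cong (λ q → if q then y' k else y k) R̄[k]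

  splitting : ∀ {m n} {U : Tensor F (suc m) n} → IsSimple F U → Splitting U
  splitting (true ∷ R , _ , 1≤|R̄| , A , B , _ , _ , U≈AB) = record
    { Ũ        = blockProduct R R̄ complement A B
    ; Ũ-ext    = blockProduct-ext R R̄ complement A B
    ; U≈Ũ      = U≈AB
    ; Q        = Vec.lookup R̄
    ; k₀       = proj₁ (∃-lookup-true R̄ 1≤|R̄|)
    ; Q-k₀     = proj₂ (∃-lookup-true R̄ 1≤|R̄|)
    ; exchange = blockProduct-exchange R R̄ complement A B
    }
    where
    R̄ = Vec.map not R
    complement : ∀ k → Vec.lookup R̄ k ≡ not (Vec.lookup R k)
    complement k = Vec.lookup-map k not R
  splitting (false ∷ R̄ , 1≤|R̄| , _ , B , A , _ , _ , U≈BA) = record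
    { Ũ        = blockProduct R R̄ complement A B
    ; Ũ-ext    = blockProduct-ext R R̄ complement A B
    ; U≈Ũ      = λ x → trans (U≈BA x) (*-comm _ _)
    ; Q        = Vec.lookup R̄
    ; k₀       = proj₁ (∃-lookup-true R̄ 1≤|R̄|)
    ; Q-k₀     = proj₂ (∃-lookup-true R̄ 1≤|R̄|)
    ; exchange = blockProduct-exchange R R̄ complement A B
    }
    where
    R = Vec.map not R̄
    complement : ∀ k → Vec.lookup R̄ k ≡ not (Vec.lookup R k)
    complement k = ≡.trans (≡.sym (not-involutive _)) (≡.cong not (≡.sym (Vec.lookup-map k not R̄)))

  hdet-expand : ∀ {m n r} (T : Tensor F (suc m) n) (W : Fin r → (Fin (suc m) → Fin n) → Carrier) →
    (∀ x → T x ≈ ∑ (allFin r) (λ j → W j x)) →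
    hdet F T ≈ ∑Fun n (allFin r) (λ f → ∑Fun m (allMaps n) (term (W ∘ f)))
  hdet-expand {m} {n} {r} T W T≈∑W = begin
    hdet F T
      ≈⟨ ∑Fun-cong m L (λ σ → *-congˡ (∏-cong (allFin n) λ i → T≈∑W (row σ i))) ⟩
    ∑Fun m L (λ σ → signs σ * ∏ (allFin n) (λ i → ∑ (allFin r) (λ j → W j (row σ i))))
      ≈⟨ ∑Fun-cong m L (λ σ → *-congˡ (∏-∑ n (allFin r) (λ i j → W j (row σ i)))) ⟩
    ∑Fun m L (λ σ → signs σ * ∑Fun n (allFin r) (λ f → ∏ (allFin n) (λ i → W (f i) (row σ i))))
      ≈⟨ ∑Fun-cong m L (λ σ → *-distribˡ-∑ (allFuns n (allFin r)) (signs σ) _) ⟩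
    ∑Fun m L (λ σ → ∑Fun n (allFin r) (λ f → term (W ∘ f) σ))
      ≈⟨ ∑-comm (allFuns m L) (allFuns n (allFin r)) (λ σ f → term (W ∘ f) σ) ⟩
    ∑Fun n (allFin r) (λ f → ∑Fun m L (term (W ∘ f))) ∎
    where
    L = allMaps n
    signs : (Fin m → Fin n → Fin n) → Carrier
    signs σ = ∏ (allFin m) (λ k → sign (σ k))
    row : (Fin m → Fin n → Fin n) → Fin n → Fin (suc m) → Fin n
    row σ i = i Vector.∷ λ k → σ k i

  hdet-vanishes : ∀ {m n r} p → ι F (suc (suc p)) ≈ 0# → r ℕ.* suc p < n →
    (T : Tensor F (suc m) n) → SumOfSimple F r T → hdet F T ≈ 0#
  hdet-vanishes {m} {n} {r} p p≈0 r*p<n T (U , simple , T≈∑U) = begin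
    hdet F T                                                    ≈⟨ hdet-expand T Ũ T≈∑Ũ ⟩
    ∑Fun n (allFin r) (λ f → ∑Fun m (allMaps n) (term (Ũ ∘ f)))
      ≈⟨ ∑-zero (allFuns n (allFin r)) (λ {f} _ → vanishes f) ⟩
    0# ∎
    where
    split : ∀ j → Splitting (U j)
    split j = splitting (simple j)
    Ũ : Fin r → (Fin (suc m) → Fin n) → Carrier
    Ũ j = Splitting.Ũ (split j)
    T≈∑Ũ : ∀ x → T x ≈ ∑ (allFin r) (λ j → Ũ j x)
    T≈∑Ũ x = trans (T≈∑U x) (∑-cong (allFin r) λ j → Splitting.U≈Ũ (split j) x)
    Ũ-ext : ∀ j → Extensional (Ũ j)
    Ũ-ext j = Splitting.Ũ-ext (split j)
    vanishes : ∀ f → ∑Fun m (allMaps n) (term (Ũ ∘ f)) ≈ 0#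
    vanishes f with pigeonhole (suc p) f r*p<n
    ... | j , 1+p<|fibre| =
      ∑term-vanishes (Ũ ∘ f) (Ũ-ext ∘ f) Q Q-k₀ exchange′ p p≈0
        (fibre-unique f j) (fibre-sound f j) 1+p<|fibre|
      where
      open Splitting (split j) using (Q; Q-k₀; exchange)
      exchange′ : ∀ {c c'} → f c ≡ j → f c' ≡ j → Exchangeable (Ũ ∘ f) (Ũ-ext ∘ f) Q c c'
      exchange′ {c} {c'} fc≡j fc'≡j rewrite fc≡j | fc'≡j = exchange c c'

open import Data.Nat using (_*_)

theorem4p5 : {c ℓ : Level} (F : Field c ℓ) (p : ℕ) → HasCharacteristic F p →
    (m n : ℕ) → 1 ≤ m → 1 ≤ n → (T : Tensor F (suc m) n) →
    (r : ℕ) → r * (p ∸ 1) < n → SumOfSimple F r T →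
    Field._≈_ F (hdet F T) (Field.0# F)
theorem4p5 F zero          (() , _)      _ _ _ _ _ _ _     _
theorem4p5 F (suc zero)    (_ , 1≈0 , _) _ _ _ _ _ _ _     _ =
  ⊥-elim (Field.1≉0 F (Field.trans F (Field.sym F (Field.+-identityʳ F (Field.1# F))) 1≈0))
theorem4p5 F (suc (suc p)) (_ , p≈0 , _) _ _ _ _ T _ r*p<n T-simple = hdet-vanishes F p p≈0 r*p<n T T-simple
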